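{- Let $n\ge1$, let $\Delta^+$ be the positive roots of type $A_n$ with the root order, let $\mathcal Y$ be the OY-number and $\Gamma\mapsto\Gamma^*$ the duality on $\mathrm{AN}(\Delta^+)$. Then $\mathcal Y(\Gamma)=\mathcal Y(\Gamma^*)$ for every $\Gamma\in\mathrm{AN}(\Delta^+)$.
   Context: Write $\Delta^+=\{\varepsilon_i-\varepsilon_{j+1}\mid 1\le i\le j\le n\}$ with simple roots $\alpha_i=\varepsilon_i-\varepsilon_{i+1}$, and denote the root $\alpha_i+\dots+\alpha_j$ by $(i,j)$. The root order is $x\preccurlyeq y$ iff $y-x$ is a non-negative integral combination of simple roots. An antichain is a set of mutually incomparable roots (including $\varnothing$); $\mathrm{AN}(\Delta^+)$ is the set of antichains. For $\Gamma$ an antichain, $\mathcal I(\Gamma)=\{x\in\Delta^+\mid\exists\gamma\in\Gamma,\ \gamma\preccurlyeq x\}$; for a subset $S$, $S_{min}$ is its set of minimal elements. OY-number: for a non-empty antichain $\Gamma=\{\gamma_1,\dots,\gamma_k\}$ with $\mathcal I=\mathcal I(\Gamma)$, set $r_\Gamma(\gamma_s)=\#(\mathcal I\setminus\{\gamma_s\})_{min}-\#\mathcal I_{min}+1$ and $\mathcal Y(\Gamma)=\sum_{s=1}^k r_\Gamma(\gamma_s)$; set $\mathcal Y(\varnothing)=0$. A set $\Gamma=\{(i_1,j_1),\dots,(i_k,j_k)\}$ with $i_1<\dots<i_k$ is an antichain iff $j_1<\dots<j_k$ and $i_s\le j_s$ for all $s$; it is encoded by the sequences $\mathbf i=(i_1,\dots,i_k)$,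 $\mathbf j=(j_1,\dots,j_k)$ in $[n]=\{1,\dots,n\}$. Duality: $\Gamma^*$ is the antichain with sequences $\mathbf i^*=[n]\setminus\mathbf j$ and $\mathbf j^*=[n]\setminus\mathbf i$ (each listed increasingly and paired in order); this is again an antichain. -}

module Defs where

open import Data.Nat using (ℕ; zero; suc; _≤_; _≤ᵇ_; _≡ᵇ_)
open import Data.Bool using (Bool; true; false; _∧_; not; if_then_else_)
open import Data.Product using (_×_; _,_; proj₁; proj₂)
open import Data.List using (List; []; _∷_; map; upTo; filter; length; concatMap; zip)
open import Data.Bool.ListAction using (all; any)
open import Data.List.Relation.Unary.All using (All)
open import Data.List.Relation.Unary.AllPairs using (AllPairs)
open import Data.Integer using (ℤ; +_; _-_; _+_)
import Data.Integer as ℤ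
open import Data.Unit using (⊤)
open import Data.Empty using (⊥)
open import Relation.Nullary using (¬_)
open import Relation.Nullary.Decidable using (T?)

-- The root (i , j) stands for α_i + ... + α_j, i.e. ε_i - ε_{j+1}, 1 ≤ i ≤ j ≤ n.
Root : Set
Root = ℕ × ℕ

IsRoot : ℕ → Root → Set
IsRoot n (i , j) = (1 ≤ i) × (i ≤ j) × (j ≤ n)

range : ℕ → List ℕ
range n = map suc (upTo n)

posRoots : ℕ → List Root
posRoots n = concatMap (λ i → map (λ j → (i , j)) (filter (λ j → T? (i ≤ᵇ j)) (range n))) (range n)

coeff : Root → ℕ → ℕ
coeff (i , j) k = if (i ≤ᵇ k) ∧ (k ≤ᵇ j) then 1 else 0

-- root order in A_n: x ≼ y iff y - x is a non-negative integral combination of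
-- the simple roots α_1 … α_n, i.e. coefficientwise ≤
_≼⟨_⟩_ : Root → ℕ → Root → Bool
x ≼⟨ n ⟩ y = all (λ k → coeff x k ≤ᵇ coeff y k) (range n)

eqRoot : Root → Root → Bool
eqRoot (i , j) (i' , j') = (i ≡ᵇ i') ∧ (j ≡ᵇ j')

Incomparable : ℕ → Root → Root → Set
Incomparable n x y = (¬ Data.Bool.T (x ≼⟨ n ⟩ y)) × (¬ Data.Bool.T (y ≼⟨ n ⟩ x))

-- an antichain of Δ⁺(A_n): a list of positive roots, pairwise incomparable
-- (in particular without repetitions); represents the finite set of its entries
IsAntichain : ℕ → List Root → Set
IsAntichain n Γ = All (IsRoot n) Γ × AllPairs (Incomparable n) Γ

member : Root → List Root → Bool
member x S = any (eqRoot x) S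

ideal : ℕ → List Root → List Root
ideal n Γ = filter (λ x → T? (any (λ γ → γ ≼⟨ n ⟩ x) Γ)) (posRoots n)

minimals : ℕ → List Root → List Root
minimals n S = filter (λ x → T? (not (any (λ y → (y ≼⟨ n ⟩ x) ∧ not (eqRoot y x)) S))) S

remove : Root → List Root → List Root
remove γ S = filter (λ x → T? (not (eqRoot x γ))) S

rΓ : ℕ → List Root → Root → ℤ
rΓ n Γ γ = (+ length (minimals n (remove γ (ideal n Γ))) - + length (minimals n (ideal n Γ))) + + 1

sumℤ : List ℤ → ℤ
sumℤ [] = + 0
sumℤ (x ∷ xs) = x + sumℤ xs

OY : ℕ → List Root → ℤ
OY n Γ = sumℤ (map (rΓ n Γ) Γ)

-- duality: 𝐢* = [n] \ 𝐣 , 𝐣* = [n] \ 𝐢, both increasing, paired in order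
dual : ℕ → List Root → List Root
dual n Γ = zip istar jstar
  where
  is js : List ℕ
  is = map proj₁ Γ
  js = map proj₂ Γ
  istar = filter (λ k → T? (not (any (k ≡ᵇ_) js))) (range n)
  jstar = filter (λ k → T? (not (any (k ≡ᵇ_) is))) (range n)

-- Write 𝐢, 𝐣 for the coordinate lists of the antichain Γ. Removing γ = (i, j) from the upper
-- ideal 𝓘(Γ) removes the minimal element γ, and the only roots that can become minimal are the two
-- roots (i-1, j) and (i, j+1) covering γ: the first does iff i ≥ 2 and i-1 ∉ 𝐢, the second iff
-- j < n and j+1 ∉ 𝐣. Hence r_Γ(i, j) = [i ≥ 2, i-1 ∉ 𝐢] + [j < n, j+1 ∉ 𝐣] and 𝒴(Γ) = L(𝐢) + R(𝐣),
-- where L(S) counts the k ∈ S with 2 ≤ k, k-1 ∉ S and R(S) the k ∈ S with k < n, k+1 ∉ S.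
-- Both L(S) and R([n] ∖ S) count the k < n with k ∉ S, k+1 ∈ S, and symmetrically for R(S) and
-- L([n] ∖ S); as 𝐢* = [n] ∖ 𝐣 and 𝐣* = [n] ∖ 𝐢 this gives 𝒴(Γ) = L(𝐢*) + R(𝐣*) = 𝒴(Γ*), once Γ* is
-- known to be an antichain. That amounts to i*_s ≤ j*_s: since i_s ≤ j_s, for every m the list 𝐣
-- has at most as many entries ≤ m as 𝐢, so by complementation 𝐣* has at most as many as 𝐢*, and
-- for increasing lists this domination of counting functions forces the entrywise inequality.

module Submission where

open import Defs
open import Data.Bool using (Bool; true; false; T; not; _∧_; _∨_; if_then_else_)
open import Data.Bool.Properties using (∧-comm; ∧-identityʳ; ∧-zeroʳ; not-involutive; T-∧; T-∨)
open import Data.Bool.ListAction using (any)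
open import Data.Empty using (⊥-elim)
open import Data.Integer using (ℤ)
import Data.Integer as ℤ
open import Data.Integer.Properties using (pos-+)
open import Data.Integer.Tactic.RingSolver using (solve-∀)
open import Data.List using (List; []; _∷_; map; filter; length; _++_; _∷ʳ_; upTo; zip)
open import Data.List.Properties using (map-upTo; upTo-∷ʳ; map-++; length-map)
open import Data.List.Membership.Propositional using (_∈_; _∉_; find; lose)
open import Data.List.Membership.Propositional.Properties
  using (∈-map⁺; ∈-map⁻; ∈-filter⁺; ∈-filter⁻; ∈-upTo⁺; ∈-upTo⁻; ∈-concatMap⁺; ∈-concatMap⁻)
open import Data.List.Relation.Unary.All as All using (All; []; _∷_)
import Data.List.Relation.Unary.All.Properties as All
open import Data.List.Relation.Unary.Any as Any using (here; there)
open import Data.List.Relation.Unary.Any.Properties using (any⁺; any⁻)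
open import Data.List.Relation.Unary.AllPairs as AllPairs using (AllPairs; []; _∷_)
import Data.List.Relation.Unary.AllPairs.Properties as AllPairs
open import Data.List.Relation.Binary.Disjoint.Propositional using (Disjoint)
open import Data.List.Relation.Binary.Subset.Propositional using (_⊆_)
open import Data.List.Relation.Unary.Unique.Propositional using (Unique)
import Data.List.Relation.Unary.Unique.Propositional.Properties as Unique
open import Data.Nat using (ℕ; zero; suc; pred; _+_; _≤_; _<_; _≤ᵇ_; _≡ᵇ_; _≤?_; _≟_; s≤s; s≤s⁻¹; z≤n)
open import Data.Nat.Properties
open import Algebra.Properties.CommutativeSemigroup +-commutativeSemigroup using (interchange)
open import Data.Product using (_×_; _,_; proj₁; proj₂; ∃-syntax; uncurry)
open import Data.Product.Properties using (≡-dec)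
open import Data.Sum as Sum using (_⊎_; inj₁; inj₂)
open import Function using (_∘_; Equivalence)
open import Relation.Nullary using (¬_; yes; no)
open import Relation.Nullary.Decidable using (T?)
open import Relation.Binary.PropositionalEquality

private variable
  A B : Set

-- Finite sums and indicator counts

χ : Bool → ℕ
χ b = if b then 1 else 0

∑ : (A → ℕ) → List A → ℕ
∑ f []       = 0
∑ f (x ∷ xs) = f x + ∑ f xs

count : (A → Bool) → List A → ℕ
count p = ∑ (λ x → χ (p x))

if-T : ∀ {b} {u v : ℕ} → T b → (if b then u else v) ≡ u
if-T {true} _ = refl

if-¬T : ∀ {b} {u v : ℕ} → ¬ T b → (if b then u else v) ≡ v
if-¬T {true}  ¬b = ⊥-elim (¬b _)
if-¬T {false} _  = refl

if-idem : ∀ b {u : ℕ} → (if b then u else u) ≡ u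
if-idem true  = refl
if-idem false = refl

if-∨ : ∀ {a b} {u : ℕ} → (T a → ¬ T b) → (if a ∨ b then u else 0) ≡ (if a then u else 0) + (if b then u else 0)
if-∨ {true}  {true}  a⇒¬b = ⊥-elim (a⇒¬b _ _)
if-∨ {true}  {false} {u} _ = sym (+-identityʳ u)
if-∨ {false}             _ = refl

χ-∧ : ∀ a b → (if a then χ b else 0) ≡ χ (a ∧ b)
χ-∧ true  _ = refl
χ-∧ false _ = refl

T-not⁺ : ∀ {b} → ¬ T b → T (not b)
T-not⁺ {false} _  = _
T-not⁺ {true}  ¬b = ¬b _

T-not⁻ : ∀ {b} → T (not b) → ¬ T b
T-not⁻ {false} _ ()

T-ext : ∀ {a b} → (T a → T b) → (T b → T a) → a ≡ b
T-ext {false} {false} _ _ = refl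
T-ext {false} {true}  _ b⇒a = ⊥-elim (b⇒a _)
T-ext {true}  {false} a⇒b _ = ⊥-elim (a⇒b _)
T-ext {true}  {true}  _ _ = refl

-- Indicator form of a = (b ∖ {g}) ⊎ u ⊎ v for g ∈ b and pairwise disjoint b, u, v.
χ-partition : ∀ b g u v → (T g → T b) → (T b → ¬ T u) → (T b → ¬ T v) → (T u → ¬ T v) →
  χ ((b ∧ not g) ∨ (u ∨ v)) + χ g ≡ χ b + (χ u + χ v)
χ-partition true  true  false false _   _    _    _    = refl
χ-partition true  false false false _   _    _    _    = refl
χ-partition true  _     true  _     _   b⇒¬u _    _    = ⊥-elim (b⇒¬u _ _)
χ-partition true  _     false true  _   _    b⇒¬v _    = ⊥-elim (b⇒¬v _ _)
χ-partition false true  _     _     g⇒b _    _    _    = ⊥-elim (g⇒b _)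
χ-partition false false true  true  _   _    _    u⇒¬v = ⊥-elim (u⇒¬v _ _)
χ-partition false false true  false _   _    _    _    = refl
χ-partition false false false true  _   _    _    _    = refl
χ-partition false false false false _   _    _    _    = refl

∑-cong : {f g : A → ℕ} (xs : List A) → (∀ {x} → x ∈ xs → f x ≡ g x) → ∑ f xs ≡ ∑ g xs
∑-cong []       _  = refl
∑-cong (x ∷ xs) eq = cong₂ _+_ (eq (here refl)) (∑-cong xs (eq ∘ there))

∑-zero : {f : A → ℕ} (xs : List A) → (∀ {x} → x ∈ xs → f x ≡ 0) → ∑ f xs ≡ 0
∑-zero []       _  = refl
∑-zero (x ∷ xs) eq = cong₂ _+_ (eq (here refl)) (∑-zero xs (eq ∘ there))

∑-mono : {f g : A → ℕ} (xs : List A) → (∀ {x} → x ∈ xs → f x ≤ g x) → ∑ f xs ≤ ∑ g xs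
∑-mono []       _  = z≤n
∑-mono (x ∷ xs) le = +-mono-≤ (le (here refl)) (∑-mono xs (le ∘ there))

∑-+ : (f g : A → ℕ) (xs : List A) → ∑ (λ x → f x + g x) xs ≡ ∑ f xs + ∑ g xs
∑-+ f g []       = refl
∑-+ f g (x ∷ xs) = trans (cong (f x + g x +_) (∑-+ f g xs)) (interchange (f x) (g x) (∑ f xs) (∑ g xs))

∑-++ : (f : A → ℕ) (xs ys : List A) → ∑ f (xs ++ ys) ≡ ∑ f xs + ∑ f ys
∑-++ f []       ys = refl
∑-++ f (x ∷ xs) ys = trans (cong (f x +_) (∑-++ f xs ys)) (sym (+-assoc (f x) (∑ f xs) (∑ f ys)))

∑-map : (f : B → ℕ) (g : A → B) (xs : List A) → ∑ f (map g xs) ≡ ∑ (f ∘ g) xs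
∑-map f g []       = refl
∑-map f g (x ∷ xs) = cong (f (g x) +_) (∑-map f g xs)

∑-filter : (p : A → Bool) (f : A → ℕ) (xs : List A) →
  ∑ f (filter (T? ∘ p) xs) ≡ ∑ (λ x → if p x then f x else 0) xs
∑-filter p f []       = refl
∑-filter p f (x ∷ xs) with p x
... | true  = cong (f x +_) (∑-filter p f xs)
... | false = ∑-filter p f xs

length≡∑ : (xs : List A) → length xs ≡ ∑ (λ _ → 1) xs
length≡∑ []       = refl
length≡∑ (x ∷ xs) = cong suc (length≡∑ xs)

length≡count : (p : A → Bool) (xs : List A) → length (filter (T? ∘ p) xs) ≡ count p xs
length≡count p xs = trans (length≡∑ (filter (T? ∘ p) xs)) (∑-filter p (λ _ → 1) xs)

count-filter : (p q : A → Bool) (xs : List A) → count p (filter (T? ∘ q) xs) ≡ count (λ x → q x ∧ p x) xs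
count-filter p q xs = trans (∑-filter q _ xs) (∑-cong xs λ {x} _ → χ-∧ (q x) (p x))

module _ {_==_ : A → A → Bool} (==⇒≡ : ∀ {x y} → T (x == y) → x ≡ y) (==-refl : ∀ x → T (x == x)) where

  ∑-δ : (f : A → ℕ) {x : A} {ys : List A} → Unique ys → x ∈ ys →
    ∑ (λ k → if k == x then f k else 0) ys ≡ f x
  ∑-δ f {x} (x∉ys ∷ _) (here refl) =
    trans (cong₂ _+_ (if-T (==-refl x)) (∑-zero _ λ k∈ys → if-¬T λ k==x → All.lookup x∉ys k∈ys (sym (==⇒≡ k==x))))
      (+-identityʳ (f x))
  ∑-δ f (k∉ys ∷ ys!) (there x∈ys) =
    cong₂ _+_ (if-¬T λ k==x → All.lookup k∉ys x∈ys (==⇒≡ k==x)) (∑-δ f ys! x∈ys)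

χ-≤ᵇ-antitone : ∀ {a b} m → a ≤ b → χ (b ≤ᵇ m) ≤ χ (a ≤ᵇ m)
χ-≤ᵇ-antitone {a} {b} m a≤b with T? (b ≤ᵇ m)
... | yes b≤m = ≤-reflexive (trans (if-T b≤m) (sym (if-T (≤⇒≤ᵇ (≤-trans a≤b (≤ᵇ⇒≤ b m b≤m))))))
... | no  b≰m = subst (_≤ _) (sym (if-¬T b≰m)) z≤n

count-above : ∀ {m zs} → All (m <_) zs → count (_≤ᵇ m) zs ≡ 0
count-above m<zs = ∑-zero _ λ z∈ → if-¬T λ z≤m → <⇒≱ (All.lookup m<zs z∈) (≤ᵇ⇒≤ _ _ z≤m)

count-below : ∀ {m z} zs → z ≤ m → count (_≤ᵇ m) (z ∷ zs) ≡ suc (count (_≤ᵇ m) zs)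
count-below _ z≤m = cong (_+ _) (if-T (≤⇒≤ᵇ z≤m))

sumℤ-map : (f : A → ℤ) (g : A → ℕ) {xs : List A} → (∀ {x} → x ∈ xs → f x ≡ ℤ.+ g x) →
  sumℤ (map f xs) ≡ ℤ.+ ∑ g xs
sumℤ-map f g {[]}     _  = refl
sumℤ-map f g {x ∷ xs} eq =
  trans (cong₂ ℤ._+_ (eq (here refl)) (sumℤ-map f g (eq ∘ there))) (sym (pos-+ (g x) (∑ g xs)))

difference-from-sum : ∀ a b {c} → a + 1 ≡ b + c → (ℤ.+ a ℤ.- ℤ.+ b) ℤ.+ ℤ.+ 1 ≡ ℤ.+ c
difference-from-sum a b {c} a+1≡b+c = begin
  (ℤ.+ a ℤ.- ℤ.+ b) ℤ.+ ℤ.+ 1   ≡⟨ reassociate (ℤ.+ a) (ℤ.+ b) ⟩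
  (ℤ.+ a ℤ.+ ℤ.+ 1) ℤ.- ℤ.+ b   ≡⟨ cong (ℤ._- ℤ.+ b) (trans (sym (pos-+ a 1)) (trans (cong ℤ.+_ a+1≡b+c) (pos-+ b c))) ⟩
  (ℤ.+ b ℤ.+ ℤ.+ c) ℤ.- ℤ.+ b   ≡⟨ cancel (ℤ.+ b) (ℤ.+ c) ⟩
  ℤ.+ c                         ∎
  where
  open ≡-Reasoning
  reassociate : ∀ x y → (x ℤ.- y) ℤ.+ ℤ.+ 1 ≡ (x ℤ.+ ℤ.+ 1) ℤ.- y
  reassociate = solve-∀
  cancel : ∀ y z → (y ℤ.+ z) ℤ.- y ≡ z
  cancel = solve-∀

-- Lists: zipping and a ballot-type comparison

All-zip : {P : A → Set} {Q : B → Set} {xs : List A} {ys : List B} → All P xs → All Q ys →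
  All (λ (x , y) → P x × Q y) (zip xs ys)
All-zip []         _          = []
All-zip (_ ∷ _)    []         = []
All-zip (px ∷ pxs) (qy ∷ qys) = (px , qy) ∷ All-zip pxs qys

AllPairs-zip : {R : A → A → Set} {S : B → B → Set} {xs : List A} {ys : List B} → AllPairs R xs → AllPairs S ys →
  AllPairs (λ (a , b) (c , d) → R a c × S b d) (zip xs ys)
AllPairs-zip []             _              = []
AllPairs-zip (_ ∷ _)        []             = []
AllPairs-zip (Rx ∷ xs-pairs) (Sy ∷ ys-pairs) = All-zip Rx Sy ∷ AllPairs-zip xs-pairs ys-pairs

map-proj₁-zip : (xs : List A) (ys : List B) → length xs ≡ length ys → map proj₁ (zip xs ys) ≡ xs
map-proj₁-zip []       []       _   = refl
map-proj₁-zip (x ∷ xs) (y ∷ ys) eq = cong (x ∷_) (map-proj₁-zip xs ys (suc-injective eq))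

map-proj₂-zip : (xs : List A) (ys : List B) → length xs ≡ length ys → map proj₂ (zip xs ys) ≡ ys
map-proj₂-zip []       []       _   = refl
map-proj₂-zip (x ∷ xs) (y ∷ ys) eq = cong (y ∷_) (map-proj₂-zip xs ys (suc-injective eq))

zip-≤ : ∀ {xs ys} → AllPairs _<_ xs → AllPairs _<_ ys →
  (∀ m → count (_≤ᵇ m) ys ≤ count (_≤ᵇ m) xs) → All (uncurry _≤_) (zip xs ys)
zip-≤ {[]}                 _          _          _   = []
zip-≤ {_ ∷ _}  {[]}        _          _          _   = []
zip-≤ {x ∷ xs} {y ∷ ys} (x<xs ∷ xs↑) (y<ys ∷ ys↑) dom = x≤y ∷ zip-≤ xs↑ ys↑ dom′
  where
  x≤y : x ≤ y
  x≤y with x ≤? y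
  ... | yes x≤y = x≤y
  ... | no  x≰y = ⊥-elim (n≮0 (subst₂ _≤_ (count-below ys ≤-refl) (count-above x∷xs>y) (dom y)))
    where
    x∷xs>y : All (y <_) (x ∷ xs)
    x∷xs>y = ≰⇒> x≰y ∷ All.map (<-trans (≰⇒> x≰y)) x<xs
  dom′ : ∀ m → count (_≤ᵇ m) ys ≤ count (_≤ᵇ m) xs
  dom′ m with y ≤? m
  ... | yes y≤m = s≤s⁻¹ (subst₂ _≤_ (count-below ys y≤m) (count-below xs (≤-trans x≤y y≤m)) (dom m))
  ... | no  y≰m = subst (_≤ _) (sym (count-above (All.map (<-trans (≰⇒> y≰m)) y<ys))) z≤n

-- The interval [n] and its subsets

mem : ℕ → List ℕ → Bool
mem k xs = any (k ≡ᵇ_) xs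

mem⁺ : ∀ {k xs} → k ∈ xs → T (mem k xs)
mem⁺ {k} k∈xs = any⁺ _ (Any.map (λ { refl → ≡⇒≡ᵇ k k refl }) k∈xs)

mem⁻ : ∀ {k xs} → T (mem k xs) → k ∈ xs
mem⁻ {k} {xs} t = Any.map (≡ᵇ⇒≡ k _) (any⁻ _ xs t)

∑-mem : (f : ℕ → ℕ) {xs ys : List ℕ} → Unique xs → Unique ys → xs ⊆ ys →
  ∑ (λ k → if mem k xs then f k else 0) ys ≡ ∑ f xs
∑-mem f {[]} {ys} _ _ _ = ∑-zero ys λ _ → refl
∑-mem f {x ∷ xs} {ys} (x∉xs ∷ xs!) ys! x∷xs⊆ys = begin
  ∑ (λ k → if (k ≡ᵇ x) ∨ mem k xs then f k else 0) ys
    ≡⟨ ∑-cong ys (λ {k} _ → if-∨ (k≡x⇒k∉xs {k})) ⟩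
  ∑ (λ k → (if k ≡ᵇ x then f k else 0) + (if mem k xs then f k else 0)) ys
    ≡⟨ ∑-+ _ _ ys ⟩
  ∑ (λ k → if k ≡ᵇ x then f k else 0) ys + ∑ (λ k → if mem k xs then f k else 0) ys
    ≡⟨ cong₂ _+_ (∑-δ (≡ᵇ⇒≡ _ _) (λ k → ≡⇒≡ᵇ k k refl) f ys! (x∷xs⊆ys (here refl)))
                 (∑-mem f xs! ys! (x∷xs⊆ys ∘ there)) ⟩
  f x + ∑ f xs ∎
  where
  open ≡-Reasoning
  k≡x⇒k∉xs : ∀ {k} → T (k ≡ᵇ x) → ¬ T (mem k xs)
  k≡x⇒k∉xs {k} k≡x k∈xs = All.lookup x∉xs (mem⁻ k∈xs) (sym (≡ᵇ⇒≡ k x k≡x))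

range-suc : ∀ n → range (suc n) ≡ 1 ∷ map suc (range n)
range-suc n = cong (λ xs → 1 ∷ map suc xs) (sym (map-upTo suc n))

range-∷ʳ : ∀ n → range (suc n) ≡ range n ∷ʳ suc n
range-∷ʳ n = trans (cong (map suc) (sym (upTo-∷ʳ n))) (map-++ suc (upTo n) (n ∷ []))

∈-range⁺ : ∀ {n k} → 1 ≤ k → k ≤ n → k ∈ range n
∈-range⁺ {k = suc k} _ k<n = ∈-map⁺ suc (∈-upTo⁺ k<n)

∈-range⁻ : ∀ {n k} → k ∈ range n → 1 ≤ k × k ≤ n
∈-range⁻ k∈ with ∈-map⁻ suc k∈
... | _ , k∈upTo , refl = s≤s z≤n , ∈-upTo⁻ k∈upTo

range-unique : ∀ n → Unique (range n)
range-unique n = Unique.map⁺ suc-injective (Unique.upTo⁺ n)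

range-increasing : ∀ n → AllPairs _<_ (range n)
range-increasing zero    = []
range-increasing (suc n) = subst (AllPairs _<_) (sym (range-suc n))
  (All.map⁺ (All.tabulate (s≤s ∘ proj₁ ∘ ∈-range⁻)) ∷ AllPairs.map⁺ (AllPairs.map s≤s (range-increasing n)))

∑-range-from-2 : (g : ℕ → ℕ) (n : ℕ) → ∑ (λ k → if 2 ≤ᵇ k then g (pred k) else 0) (range n) ≡ ∑ g (range (pred n))
∑-range-from-2 g zero    = refl
∑-range-from-2 g (suc n) = begin
  ∑ h (range (suc n))         ≡⟨ cong (∑ h) (range-suc n) ⟩
  ∑ h (map suc (range n))     ≡⟨ ∑-map h suc (range n) ⟩
  ∑ (h ∘ suc) (range n)       ≡⟨ ∑-cong (range n) (λ k∈ → if-T (≤⇒≤ᵇ (s≤s (proj₁ (∈-range⁻ k∈))))) ⟩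
  ∑ g (range n)               ∎
  where
  open ≡-Reasoning
  h : ℕ → ℕ
  h k = if 2 ≤ᵇ k then g (pred k) else 0

∑-range-to-pred : (g : ℕ → ℕ) (n : ℕ) → ∑ (λ k → if suc k ≤ᵇ n then g k else 0) (range n) ≡ ∑ g (range (pred n))
∑-range-to-pred g zero    = refl
∑-range-to-pred g (suc n) = begin
  ∑ h (range (suc n))           ≡⟨ cong (∑ h) (range-∷ʳ n) ⟩
  ∑ h (range n ++ suc n ∷ [])   ≡⟨ ∑-++ h (range n) (suc n ∷ []) ⟩
  ∑ h (range n) + (h (suc n) + 0) ≡⟨ cong (∑ h (range n) +_) (trans (+-identityʳ _) (if-¬T (n≮n (suc n) ∘ ≤ᵇ⇒≤ _ _))) ⟩
  ∑ h (range n) + 0             ≡⟨ +-identityʳ _ ⟩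
  ∑ h (range n)                 ≡⟨ ∑-cong (range n) (λ k∈ → if-T (≤⇒≤ᵇ (s≤s (proj₂ (∈-range⁻ k∈))))) ⟩
  ∑ g (range n)                 ∎
  where
  open ≡-Reasoning
  h : ℕ → ℕ
  h k = if suc k ≤ᵇ suc n then g k else 0

∈-range-pred : ∀ {n k} → k ∈ range (pred n) → k ∈ range n × suc k ∈ range n
∈-range-pred {suc n} k∈ with ∈-range⁻ k∈
... | 1≤k , k≤n = ∈-range⁺ 1≤k (m≤n⇒m≤1+n k≤n) , ∈-range⁺ (s≤s z≤n) (s≤s k≤n)

compl : ℕ → List ℕ → List ℕ
compl n xs = filter (λ k → T? (not (mem k xs))) (range n)

compl-unique : ∀ n xs → Unique (compl n xs)
compl-unique n xs = Unique.filter⁺ _ (range-unique n)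

compl⊆range : ∀ n xs → compl n xs ⊆ range n
compl⊆range n xs = proj₁ ∘ ∈-filter⁻ _

mem-compl : ∀ {n} k xs → k ∈ range n → mem k (compl n xs) ≡ not (mem k xs)
mem-compl {n} k xs k∈ = T-ext
  (λ t → proj₂ (∈-filter⁻ (λ k → T? (not (mem k xs))) {xs = range n} (mem⁻ {k} {compl n xs} t)))
  (λ t → mem⁺ (∈-filter⁺ (λ k → T? (not (mem k xs))) k∈ t))

∑-compl : (f : ℕ → ℕ) {n : ℕ} {xs : List ℕ} → Unique xs → xs ⊆ range n →
  ∑ f (compl n xs) + ∑ f xs ≡ ∑ f (range n)
∑-compl f {n} {xs} xs! xs⊆ = begin
  ∑ f (compl n xs) + ∑ f xs
    ≡⟨ cong₂ _+_ (∑-filter (λ k → not (mem k xs)) f (range n)) (sym (∑-mem f xs! (range-unique n) xs⊆)) ⟩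
  ∑ (λ k → if not (mem k xs) then f k else 0) (range n) + ∑ (λ k → if mem k xs then f k else 0) (range n)
    ≡⟨ sym (∑-+ _ _ (range n)) ⟩
  ∑ (λ k → (if not (mem k xs) then f k else 0) + (if mem k xs then f k else 0)) (range n)
    ≡⟨ ∑-cong (range n) (λ {k} _ → split (mem k xs)) ⟩
  ∑ f (range n) ∎
  where
  open ≡-Reasoning
  split : ∀ {u} b → (if not b then u else 0) + (if b then u else 0) ≡ u
  split true  = refl
  split false = +-identityʳ _

-- Boundary counts of a subset of [n] and of its complement

leftOpen : List ℕ → ℕ → Bool
leftOpen xs k = (2 ≤ᵇ k) ∧ not (mem (pred k) xs)

rightOpen : ℕ → List ℕ → ℕ → Bool
rightOpen n xs k = (suc k ≤ᵇ n) ∧ not (mem (suc k) xs)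

leftOpen⁺ : ∀ {k xs} → 2 ≤ k → pred k ∉ xs → T (leftOpen xs k)
leftOpen⁺ 2≤k pk∉ = Equivalence.from T-∧ (≤⇒≤ᵇ 2≤k , T-not⁺ (pk∉ ∘ mem⁻))

leftOpen⁻ : ∀ {k xs} → T (leftOpen xs k) → 2 ≤ k × pred k ∉ xs
leftOpen⁻ {k} t = let 2≤k , pk∉ = Equivalence.to T-∧ t in ≤ᵇ⇒≤ 2 k 2≤k , T-not⁻ pk∉ ∘ mem⁺

rightOpen⁺ : ∀ {n k xs} → suc k ≤ n → suc k ∉ xs → T (rightOpen n xs k)
rightOpen⁺ sk≤n sk∉ = Equivalence.from T-∧ (≤⇒≤ᵇ sk≤n , T-not⁺ (sk∉ ∘ mem⁻))

rightOpen⁻ : ∀ {n k xs} → T (rightOpen n xs k) → suc k ≤ n × suc k ∉ xs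
rightOpen⁻ {n} {k} t = let sk≤n , sk∉ = Equivalence.to T-∧ t in ≤ᵇ⇒≤ (suc k) n sk≤n , T-not⁻ sk∉ ∘ mem⁺

leftBoundary : List ℕ → ℕ
leftBoundary xs = count (leftOpen xs) xs

rightBoundary : ℕ → List ℕ → ℕ
rightBoundary n xs = count (rightOpen n xs) xs

rises falls : List ℕ → ℕ → Bool
rises xs k = mem (suc k) xs ∧ not (mem k xs)
falls xs k = mem k xs ∧ not (mem (suc k) xs)

leftBoundary≡rises : ∀ {n xs} → Unique xs → xs ⊆ range n → leftBoundary xs ≡ count (rises xs) (range (pred n))
leftBoundary≡rises {n} {xs} xs! xs⊆ = begin
  leftBoundary xs
    ≡⟨ sym (∑-mem _ xs! (range-unique n) xs⊆) ⟩
  ∑ (λ k → if mem k xs then χ (leftOpen xs k) else 0) (range n)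
    ≡⟨ ∑-cong (range n) (λ {k} _ → rise-at k) ⟩
  ∑ (λ k → if 2 ≤ᵇ k then χ (rises xs (pred k)) else 0) (range n)
    ≡⟨ ∑-range-from-2 _ n ⟩
  count (rises xs) (range (pred n)) ∎
  where
  open ≡-Reasoning
  rise-at : ∀ k → (if mem k xs then χ (leftOpen xs k) else 0) ≡ (if 2 ≤ᵇ k then χ (rises xs (pred k)) else 0)
  rise-at 0             = if-idem (mem 0 xs)
  rise-at 1             = if-idem (mem 1 xs)
  rise-at (suc (suc k)) = χ-∧ (mem (2 + k) xs) _

rightBoundary≡falls : ∀ {n xs} → Unique xs → xs ⊆ range n → rightBoundary n xs ≡ count (falls xs) (range (pred n))
rightBoundary≡falls {n} {xs} xs! xs⊆ = begin
  rightBoundary n xs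
    ≡⟨ sym (∑-mem _ xs! (range-unique n) xs⊆) ⟩
  ∑ (λ k → if mem k xs then χ (rightOpen n xs k) else 0) (range n)
    ≡⟨ ∑-cong (range n) (λ {k} _ → fall-at (mem k xs) (suc k ≤ᵇ n)) ⟩
  ∑ (λ k → if suc k ≤ᵇ n then χ (falls xs k) else 0) (range n)
    ≡⟨ ∑-range-to-pred _ n ⟩
  count (falls xs) (range (pred n)) ∎
  where
  open ≡-Reasoning
  fall-at : ∀ a b {c} → (if a then χ (b ∧ c) else 0) ≡ (if b then χ (a ∧ c) else 0)
  fall-at true  true  = refl
  fall-at true  false = refl
  fall-at false true  = refl
  fall-at false false = refl

rises-compl : ∀ {n k} xs → k ∈ range (pred n) → rises (compl n xs) k ≡ falls xs k
rises-compl {n} {k} xs k∈ = begin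
  mem (suc k) (compl n xs) ∧ not (mem k (compl n xs))
    ≡⟨ cong₂ (λ a b → a ∧ not b) (mem-compl (suc k) xs sk∈) (mem-compl k xs k∈′) ⟩
  not (mem (suc k) xs) ∧ not (not (mem k xs))
    ≡⟨ cong (not (mem (suc k) xs) ∧_) (not-involutive (mem k xs)) ⟩
  not (mem (suc k) xs) ∧ mem k xs
    ≡⟨ ∧-comm (not (mem (suc k) xs)) (mem k xs) ⟩
  falls xs k ∎
  where
  open ≡-Reasoning
  k∈′ = proj₁ (∈-range-pred {n} k∈)
  sk∈ = proj₂ (∈-range-pred {n} k∈)

falls-compl : ∀ {n k} xs → k ∈ range (pred n) → falls (compl n xs) k ≡ rises xs k
falls-compl {n} {k} xs k∈ = begin
  mem k (compl n xs) ∧ not (mem (suc k) (compl n xs))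
    ≡⟨ cong₂ (λ a b → a ∧ not b) (mem-compl k xs k∈′) (mem-compl (suc k) xs sk∈) ⟩
  not (mem k xs) ∧ not (not (mem (suc k) xs))
    ≡⟨ cong (not (mem k xs) ∧_) (not-involutive (mem (suc k) xs)) ⟩
  not (mem k xs) ∧ mem (suc k) xs
    ≡⟨ ∧-comm (not (mem k xs)) (mem (suc k) xs) ⟩
  rises xs k ∎
  where
  open ≡-Reasoning
  k∈′ = proj₁ (∈-range-pred {n} k∈)
  sk∈ = proj₂ (∈-range-pred {n} k∈)

leftBoundary-compl : ∀ {n xs} → Unique xs → xs ⊆ range n → leftBoundary xs ≡ rightBoundary n (compl n xs)
leftBoundary-compl {n} {xs} xs! xs⊆ = begin
  leftBoundary xs                          ≡⟨ leftBoundary≡rises xs! xs⊆ ⟩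
  count (rises xs) (range (pred n))         ≡⟨ ∑-cong (range (pred n)) (cong χ ∘ sym ∘ falls-compl {n} xs) ⟩
  count (falls (compl n xs)) (range (pred n)) ≡⟨ sym (rightBoundary≡falls (compl-unique n xs) (compl⊆range n xs)) ⟩
  rightBoundary n (compl n xs)             ∎
  where open ≡-Reasoning

rightBoundary-compl : ∀ {n xs} → Unique xs → xs ⊆ range n → rightBoundary n xs ≡ leftBoundary (compl n xs)
rightBoundary-compl {n} {xs} xs! xs⊆ = begin
  rightBoundary n xs                       ≡⟨ rightBoundary≡falls xs! xs⊆ ⟩
  count (falls xs) (range (pred n))         ≡⟨ ∑-cong (range (pred n)) (cong χ ∘ sym ∘ rises-compl {n} xs) ⟩
  count (rises (compl n xs)) (range (pred n)) ≡⟨ sym (leftBoundary≡rises (compl-unique n xs) (compl⊆range n xs)) ⟩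
  leftBoundary (compl n xs)                ∎
  where open ≡-Reasoning

-- Roots and the root order

_⊑_ : Root → Root → Set
(a , b) ⊑ (c , d) = c ≤ a × b ≤ d

⊑-refl : ∀ {x} → x ⊑ x
⊑-refl = ≤-refl , ≤-refl

⊑-trans : ∀ {x y z} → x ⊑ y → y ⊑ z → x ⊑ z
⊑-trans (c≤a , b≤d) (e≤c , d≤f) = ≤-trans e≤c c≤a , ≤-trans b≤d d≤f

⊑-antisym : ∀ {x y} → x ⊑ y → y ⊑ x → x ≡ y
⊑-antisym (c≤a , b≤d) (a≤c , d≤b) = cong₂ _,_ (≤-antisym a≤c c≤a) (≤-antisym b≤d d≤b)

coeff-inside : ∀ {c d k} → c ≤ k → k ≤ d → coeff (c , d) k ≡ 1
coeff-inside c≤k k≤d = if-T (Equivalence.from T-∧ (≤⇒≤ᵇ c≤k , ≤⇒≤ᵇ k≤d))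

coeff-inside⁻ : ∀ c d k → 1 ≤ coeff (c , d) k → c ≤ k × k ≤ d
coeff-inside⁻ c d k 1≤coeff with (c ≤ᵇ k) ∧ (k ≤ᵇ d) in eq
... | true = let c≤k , k≤d = Equivalence.to T-∧ (subst T (sym eq) _) in ≤ᵇ⇒≤ c k c≤k , ≤ᵇ⇒≤ k d k≤d

coeff-mono : ∀ {x y} k → x ⊑ y → coeff x k ≤ coeff y k
coeff-mono {a , b} k (c≤a , b≤d) with (a ≤ᵇ k) ∧ (k ≤ᵇ b) in eq
... | false = z≤n
... | true  = let a≤k , k≤b = Equivalence.to T-∧ (subst T (sym eq) _)
              in ≤-reflexive (sym (coeff-inside (≤-trans c≤a (≤ᵇ⇒≤ a k a≤k)) (≤-trans (≤ᵇ⇒≤ k b k≤b) b≤d)))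

⊑⇒≼ : ∀ n {x y} → x ⊑ y → T (x ≼⟨ n ⟩ y)
⊑⇒≼ n x⊑y = All.all⁻ _ {xs = range n} (All.tabulate λ {k} _ → ≤⇒≤ᵇ (coeff-mono k x⊑y))

≼⇒⊑ : ∀ {n x y} → IsRoot n x → T (x ≼⟨ n ⟩ y) → x ⊑ y
≼⇒⊑ {n} {a , b} {c , d} (1≤a , a≤b , b≤n) x≼y = proj₁ (inside-at a ≤-refl a≤b) , proj₂ (inside-at b a≤b ≤-refl)
  where
  inside-at : ∀ k → a ≤ k → k ≤ b → c ≤ k × k ≤ d
  inside-at k a≤k k≤b = coeff-inside⁻ c d k (subst (_≤ coeff (c , d) k) (coeff-inside a≤k k≤b)
    (≤ᵇ⇒≤ _ _ (All.lookup (All.all⁺ _ (range n) x≼y) (∈-range⁺ (≤-trans 1≤a a≤k) (≤-trans k≤b b≤n)))))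

eqRoot⇒≡ : ∀ {x y} → T (eqRoot x y) → x ≡ y
eqRoot⇒≡ {a , b} {c , d} t = let a≡c , b≡d = Equivalence.to T-∧ t in cong₂ _,_ (≡ᵇ⇒≡ a c a≡c) (≡ᵇ⇒≡ b d b≡d)

eqRoot-refl : ∀ x → T (eqRoot x x)
eqRoot-refl (a , b) = Equivalence.from T-∧ (≡⇒≡ᵇ a a refl , ≡⇒≡ᵇ b b refl)

row : ℕ → ℕ → List Root
row n i = map (i ,_) (filter (λ j → T? (i ≤ᵇ j)) (range n))

∈-posRoots⁺ : ∀ {n x} → IsRoot n x → x ∈ posRoots n
∈-posRoots⁺ {n} {i , j} (1≤i , i≤j , j≤n) = ∈-concatMap⁺ (row n)
  (lose (∈-range⁺ 1≤i (≤-trans i≤j j≤n)) (∈-map⁺ (i ,_) (∈-filter⁺ _ (∈-range⁺ (≤-trans 1≤i i≤j) j≤n) (≤⇒≤ᵇ i≤j))))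

∈-posRoots⁻ : ∀ {n x} → x ∈ posRoots n → IsRoot n x
∈-posRoots⁻ {n} x∈ with find (∈-concatMap⁻ (row n) {xs = range n} x∈)
... | i , i∈ , x∈row with ∈-map⁻ (i ,_) x∈row
... | j , j∈filter , refl with ∈-filter⁻ (λ j → T? (i ≤ᵇ j)) {xs = range n} j∈filter
... | j∈ , i≤j = proj₁ (∈-range⁻ i∈) , ≤ᵇ⇒≤ i j i≤j , proj₂ (∈-range⁻ j∈)

posRoots-unique : ∀ n → Unique (posRoots n)
posRoots-unique n = Unique.concat⁺
  (All.map⁺ (All.tabulate λ _ → Unique.map⁺ (cong proj₂) (Unique.filter⁺ _ (range-unique n))))
  (AllPairs.map⁺ (AllPairs.map rows-disjoint (range-unique n)))
  where
  rows-disjoint : ∀ {i i′} → i ≢ i′ → Disjoint (row n i) (row n i′)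
  rows-disjoint i≢i′ (x∈ , x∈′) with ∈-map⁻ _ x∈ | ∈-map⁻ _ x∈′
  ... | _ , _ , refl | _ , _ , refl = i≢i′ refl

count-eqRoot : ∀ {n r} → IsRoot n r → count (λ x → eqRoot x r) (posRoots n) ≡ 1
count-eqRoot {n} r-root = ∑-δ eqRoot⇒≡ eqRoot-refl (λ _ → 1) (posRoots-unique n) (∈-posRoots⁺ r-root)

count-eqRoot-∧ : ∀ {n} r c → (T c → IsRoot n r) → count (λ x → eqRoot x r ∧ c) (posRoots n) ≡ χ c
count-eqRoot-∧ {n} r true  r-root =
  trans (∑-cong (posRoots n) λ {x} _ → cong χ (∧-identityʳ (eqRoot x r))) (count-eqRoot (r-root _))
count-eqRoot-∧ {n} r false _ = ∑-zero (posRoots n) λ {x} _ → cong χ (∧-zeroʳ (eqRoot x r))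

isMinimal : ℕ → List Root → Root → Bool
isMinimal n S x = not (any (λ y → (y ≼⟨ n ⟩ x) ∧ not (eqRoot y x)) S)

module _ {n : ℕ} {S : List Root} (S-roots : All (IsRoot n) S) where

  isMinimal⁺ : ∀ {x} → (∀ {y} → y ∈ S → y ⊑ x → y ≡ x) → T (isMinimal n S x)
  isMinimal⁺ {x} x-min = T-not⁺ λ t →
    let y , y∈ , below = find (any⁻ _ S t)
        y≼x , y≢x = Equivalence.to T-∧ below
    in T-not⁻ y≢x (subst (λ z → T (eqRoot y z)) (x-min y∈ (≼⇒⊑ (All.lookup S-roots y∈) y≼x)) (eqRoot-refl y))

  isMinimal⁻ : ∀ {x} → T (isMinimal n S x) → ∀ {y} → y ∈ S → y ⊑ x → y ≡ x
  isMinimal⁻ {x} x-min {y} y∈ y⊑x with T? (eqRoot y x)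
  ... | yes y≡x = eqRoot⇒≡ y≡x
  ... | no  y≢x = ⊥-elim (T-not⁻ x-min (any⁺ _ (lose y∈ (Equivalence.from T-∧ (⊑⇒≼ n y⊑x , T-not⁺ y≢x)))))

antichain-⊑⇒≡ : ∀ n {Γ g h} → AllPairs (Incomparable n) Γ → g ∈ Γ → h ∈ Γ → g ⊑ h → g ≡ h
antichain-⊑⇒≡ n _             (here refl) (here refl) _   = refl
antichain-⊑⇒≡ n (g∥Γ ∷ _)     (here refl) (there h∈)  g⊑h = ⊥-elim (proj₁ (All.lookup g∥Γ h∈) (⊑⇒≼ n g⊑h))
antichain-⊑⇒≡ n (h∥Γ ∷ _)     (there g∈)  (here refl) g⊑h = ⊥-elim (proj₂ (All.lookup h∥Γ g∈) (⊑⇒≼ n g⊑h))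
antichain-⊑⇒≡ n (_ ∷ Γ-anti)  (there g∈)  (there h∈)  g⊑h = antichain-⊑⇒≡ n Γ-anti g∈ h∈ g⊑h

incomparable⇒proj₁≢ : ∀ n {x y} → Incomparable n x y → proj₁ x ≢ proj₁ y
incomparable⇒proj₁≢ n {a , b} {_ , d} (x⋠y , y⋠x) refl with ≤-total b d
... | inj₁ b≤d = x⋠y (⊑⇒≼ n {a , b} {a , d} (≤-refl , b≤d))
... | inj₂ d≤b = y⋠x (⊑⇒≼ n {a , d} {a , b} (≤-refl , d≤b))

incomparable⇒proj₂≢ : ∀ n {x y} → Incomparable n x y → proj₂ x ≢ proj₂ y
incomparable⇒proj₂≢ n {a , b} {c , _} (x⋠y , y⋠x) refl with ≤-total a c
... | inj₁ a≤c = y⋠x (⊑⇒≼ n {c , b} {a , b} (a≤c , ≤-refl))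
... | inj₂ c≤a = x⋠y (⊑⇒≼ n {a , b} {c , b} (c≤a , ≤-refl))

increasing⇒antichain : ∀ n {Δ} → All (IsRoot n) Δ →
  AllPairs (λ x y → proj₁ x < proj₁ y × proj₂ x < proj₂ y) Δ → AllPairs (Incomparable n) Δ
increasing⇒antichain n []            []          = []
increasing⇒antichain n (x-root ∷ Δ-roots) (x<Δ ∷ Δ↑) =
  All.zipWith (λ (y-root , a<c , b<d) → incomparable x-root y-root a<c b<d) (Δ-roots , x<Δ)
    ∷ increasing⇒antichain n Δ-roots Δ↑
  where
  incomparable : ∀ {x y} → IsRoot n x → IsRoot n y → proj₁ x < proj₁ y → proj₂ x < proj₂ y → Incomparable n x y
  incomparable {x} {y} x-root y-root a<c b<d =
    (λ x≼y → <⇒≱ a<c (proj₁ (≼⇒⊑ {y = y} x-root x≼y))) ,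
    (λ y≼x → <⇒≱ b<d (proj₂ (≼⇒⊑ {y = x} y-root y≼x)))

pred≢ : ∀ {i} → 1 ≤ i → pred i ≢ i
pred≢ {suc i} _ eq = 1+n≢n (sym eq)

1≤pred⇒2≤ : ∀ {i} → 1 ≤ pred i → 2 ≤ i
1≤pred⇒2≤ {suc i} 1≤pi = s≤s 1≤pi

≡pred : ∀ {c i} → pred i ≤ c → c < i → c ≡ pred i
≡pred pi≤c c<i = ≤-antisym (<⇒≤pred c<i) pi≤c

-- The OY-number of an antichain

module Antichain {n : ℕ} {Γ : List Root} (Γ-antichain : IsAntichain n Γ) where

  Γ-roots : All (IsRoot n) Γ
  Γ-roots = proj₁ Γ-antichain

  ⊑⇒≡ : ∀ {g h} → g ∈ Γ → h ∈ Γ → g ⊑ h → g ≡ h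
  ⊑⇒≡ = antichain-⊑⇒≡ n (proj₂ Γ-antichain)

  𝐢 𝐣 : List ℕ
  𝐢 = map proj₁ Γ
  𝐣 = map proj₂ Γ

  InIdeal : Root → Set
  InIdeal x = ∃[ g ] g ∈ Γ × g ⊑ x

  NoneBelow : (Root → Set) → Root → Set
  NoneBelow P x = ∀ {y} → IsRoot n y → P y → y ⊑ x → y ≡ x

  Minimal : (Root → Set) → Root → Set
  Minimal P x = P x × NoneBelow P x

  Γ-minimal : ∀ {g} → g ∈ Γ → Minimal InIdeal g
  Γ-minimal g∈ = (_ , g∈ , ⊑-refl) , λ { _ (h , h∈ , h⊑y) y⊑g →
    ⊑-antisym y⊑g (subst (_⊑ _) (⊑⇒≡ h∈ g∈ (⊑-trans h⊑y y⊑g)) h⊑y) }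

  inIdeal : Root → Bool
  inIdeal x = any (λ g → g ≼⟨ n ⟩ x) Γ

  inIdeal⁺ : ∀ {x} → InIdeal x → T (inIdeal x)
  inIdeal⁺ (g , g∈ , g⊑x) = any⁺ _ (lose g∈ (⊑⇒≼ n g⊑x))

  inIdeal⁻ : ∀ {x} → T (inIdeal x) → InIdeal x
  inIdeal⁻ t = let g , g∈ , g≼x = find (any⁻ _ Γ t) in g , g∈ , ≼⇒⊑ (All.lookup Γ-roots g∈) g≼x

  ∈-ideal⁺ : ∀ {x} → IsRoot n x → InIdeal x → x ∈ ideal n Γ
  ∈-ideal⁺ x-root xI = ∈-filter⁺ (T? ∘ inIdeal) (∈-posRoots⁺ x-root) (inIdeal⁺ xI)

  ∈-ideal⁻ : ∀ {x} → x ∈ ideal n Γ → IsRoot n x × InIdeal x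
  ∈-ideal⁻ x∈ = let x∈R , t = ∈-filter⁻ (T? ∘ inIdeal) {xs = posRoots n} x∈ in ∈-posRoots⁻ x∈R , inIdeal⁻ t

  ideal-roots : All (IsRoot n) (ideal n Γ)
  ideal-roots = All.tabulate (proj₁ ∘ ∈-ideal⁻)

  minimalInIdeal : Root → Bool
  minimalInIdeal x = inIdeal x ∧ isMinimal n (ideal n Γ) x

  minimalInIdeal⁺ : ∀ {x} → Minimal InIdeal x → T (minimalInIdeal x)
  minimalInIdeal⁺ (xI , x-min) = Equivalence.from T-∧ (inIdeal⁺ xI ,
    isMinimal⁺ ideal-roots λ y∈ y⊑x → let y-root , yI = ∈-ideal⁻ y∈ in x-min y-root yI y⊑x)

  minimalInIdeal⁻ : ∀ {x} → T (minimalInIdeal x) → Minimal InIdeal x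
  minimalInIdeal⁻ t = let xI , x-min = Equivalence.to T-∧ t in
    inIdeal⁻ xI , λ y-root yI y⊑x → isMinimal⁻ ideal-roots x-min (∈-ideal⁺ y-root yI) y⊑x

  length-minimals : length (minimals n (ideal n Γ)) ≡ count minimalInIdeal (posRoots n)
  length-minimals = trans (length≡count _ (ideal n Γ)) (count-filter _ inIdeal (posRoots n))

  module Removal {i j : ℕ} (γ∈Γ : (i , j) ∈ Γ) where

    γ : Root
    γ = i , j

    InIdeal⁻ : Root → Set
    InIdeal⁻ x = InIdeal x × x ≢ γ

    γ-root : IsRoot n γ
    γ-root = All.lookup Γ-roots γ∈Γ

    1≤i : 1 ≤ i
    1≤i = proj₁ γ-root

    i≤j : i ≤ j
    i≤j = proj₁ (proj₂ γ-root)

    j≤n : j ≤ n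
    j≤n = proj₂ (proj₂ γ-root)

    left right : Root
    left  = pred i , j
    right = i , suc j

    LeftNew RightNew : Root → Set
    LeftNew  x = x ≡ left  × 2 ≤ i × pred i ∉ 𝐢
    RightNew x = x ≡ right × suc j ≤ n × suc j ∉ 𝐣

    γ⊑left : γ ⊑ left
    γ⊑left = pred[n]≤n , ≤-refl

    γ⊑right : γ ⊑ right
    γ⊑right = ≤-refl , n≤1+n j

    left≢γ : left ≢ γ
    left≢γ = pred≢ 1≤i ∘ cong proj₁

    right≢γ : right ≢ γ
    right≢γ = 1+n≢n ∘ cong proj₂

    left≢right : left ≢ right
    left≢right = 1+n≢n ∘ sym ∘ cong proj₂

    left-not-minimal : ¬ Minimal InIdeal left
    left-not-minimal (_ , left-min) = left≢γ (sym (left-min γ-root (γ , γ∈Γ , ⊑-refl) γ⊑left))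

    right-not-minimal : ¬ Minimal InIdeal right
    right-not-minimal (_ , right-min) = right≢γ (sym (right-min γ-root (γ , γ∈Γ , ⊑-refl) γ⊑right))

    above-γ : ∀ {x} → IsRoot n x → γ ⊑ x → x ≢ γ →
      (IsRoot n left × left ⊑ x) ⊎ (IsRoot n right × right ⊑ x)
    above-γ {a , b} (1≤a , _ , b≤n) (a≤i , j≤b) x≢γ with m≤n⇒m<n∨m≡n a≤i | m≤n⇒m<n∨m≡n j≤b
    ... | inj₁ a<i  | _         = inj₁ ((≤-trans 1≤a (<⇒≤pred a<i) , ≤-trans pred[n]≤n i≤j , j≤n) , <⇒≤pred a<i , j≤b)
    ... | inj₂ refl | inj₁ j<b  = inj₂ ((1≤i , ≤-trans i≤j (n≤1+n j) , ≤-trans j<b b≤n) , ≤-refl , j<b)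
    ... | inj₂ refl | inj₂ refl = ⊥-elim (x≢γ refl)


    left-closed : NoneBelow InIdeal⁻ left → pred i ∉ 𝐢
    left-closed left-min pi∈ with ∈-map⁻ proj₁ pi∈
    ... | (_ , d) , y∈ , refl = pred≢ 1≤i (cong proj₁ (sym (⊑⇒≡ γ∈Γ y∈ γ⊑y)))
      where
      γ⊑y : γ ⊑ (pred i , d)
      γ⊑y with ≤-total j d
      ... | inj₁ j≤d = pred[n]≤n , j≤d
      ... | inj₂ d≤j = subst (γ ⊑_) (sym (left-min (All.lookup Γ-roots y∈)
              ((_ , y∈ , ⊑-refl) , pred≢ 1≤i ∘ cong proj₁) (≤-refl , d≤j))) γ⊑left

    right-closed : NoneBelow InIdeal⁻ right → suc j ∉ 𝐣
    right-closed right-min sj∈ with ∈-map⁻ proj₂ sj∈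
    ... | (c , _) , y∈ , refl = 1+n≢n (cong proj₂ (sym (⊑⇒≡ γ∈Γ y∈ γ⊑y)))
      where
      γ⊑y : γ ⊑ (c , suc j)
      γ⊑y with ≤-total c i
      ... | inj₁ c≤i = c≤i , n≤1+n j
      ... | inj₂ i≤c = subst (γ ⊑_) (sym (right-min (All.lookup Γ-roots y∈)
              ((_ , y∈ , ⊑-refl) , 1+n≢n ∘ cong proj₂) (i≤c , ≤-refl))) γ⊑right

    left-minimal : pred i ∉ 𝐢 → NoneBelow InIdeal⁻ left
    left-minimal pi∉ {c , d} y-root ((g , g∈ , c≤e , f≤d) , y≢γ) (pi≤c , d≤j) with i ≤? c
    ... | yes i≤c = ⊥-elim (y≢γ (proj₂ (Γ-minimal γ∈Γ) y-root (g , g∈ , c≤e , f≤d) (i≤c , d≤j)))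
    ... | no  i≰c = cong₂ _,_ (≡pred pi≤c (≰⇒> i≰c)) (≤-antisym d≤j j≤d)
      where
      j≤d : j ≤ d
      j≤d with i ≤? proj₁ g
      ... | yes i≤e = subst (_≤ d) (cong proj₂ (⊑⇒≡ g∈ γ∈Γ (i≤e , ≤-trans f≤d d≤j))) f≤d
      ... | no  i≰e = ⊥-elim (pi∉ (subst (_∈ 𝐢) (≡pred (≤-trans pi≤c c≤e) (≰⇒> i≰e)) (∈-map⁺ proj₁ g∈)))

    right-minimal : suc j ∉ 𝐣 → NoneBelow InIdeal⁻ right
    right-minimal sj∉ {c , d} y-root ((g , g∈ , c≤e , f≤d) , y≢γ) (i≤c , d≤sj) with d ≤? j
    ... | yes d≤j = ⊥-elim (y≢γ (proj₂ (Γ-minimal γ∈Γ) y-root (g , g∈ , c≤e , f≤d) (i≤c , d≤j)))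
    ... | no  d≰j = cong₂ _,_ (≤-antisym c≤i i≤c) (≤-antisym d≤sj (≰⇒> d≰j))
      where
      c≤i : c ≤ i
      c≤i with proj₂ g ≤? j
      ... | yes f≤j = subst (c ≤_) (cong proj₁ (⊑⇒≡ g∈ γ∈Γ (≤-trans i≤c c≤e , f≤j))) c≤e
      ... | no  f≰j = ⊥-elim (sj∉ (subst (_∈ 𝐣) (≤-antisym (≤-trans f≤d d≤sj) (≰⇒> f≰j)) (∈-map⁺ proj₂ g∈)))

    minimal-removal⇒ : ∀ {x} → IsRoot n x → Minimal InIdeal⁻ x →
      (Minimal InIdeal x × x ≢ γ) ⊎ LeftNew x ⊎ RightNew x
    minimal-removal⇒ x-root (((g , g∈ , g⊑x) , x≢γ) , x-min) with ≡-dec _≟_ _≟_ g γ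
    ... | no g≢γ =
      inj₁ (subst (Minimal InIdeal) (x-min (All.lookup Γ-roots g∈) ((g , g∈ , ⊑-refl) , g≢γ) g⊑x) (Γ-minimal g∈) , x≢γ)
    ... | yes refl with above-γ x-root g⊑x x≢γ
    ... | inj₁ (left-root , left⊑x) with x-min left-root ((γ , γ∈Γ , γ⊑left) , left≢γ) left⊑x
    ...   | refl = inj₂ (inj₁ (refl , 1≤pred⇒2≤ (proj₁ left-root) , left-closed x-min))
    minimal-removal⇒ x-root (((g , g∈ , g⊑x) , x≢γ) , x-min) | yes refl | inj₂ (right-root , right⊑x)
      with x-min right-root ((γ , γ∈Γ , γ⊑right) , right≢γ) right⊑x
    ...   | refl = inj₂ (inj₂ (refl , proj₂ (proj₂ right-root) , right-closed x-min))

    minimal-removal⇐ : ∀ {x} → (Minimal InIdeal x × x ≢ γ) ⊎ LeftNew x ⊎ RightNew x → Minimal InIdeal⁻ x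
    minimal-removal⇐ (inj₁ ((xI , x-min) , x≢γ))    = (xI , x≢γ) , λ y-root yI⁻ → x-min y-root (proj₁ yI⁻)
    minimal-removal⇐ (inj₂ (inj₁ (refl , _ , pi∉))) = ((γ , γ∈Γ , γ⊑left) , left≢γ) , left-minimal pi∉
    minimal-removal⇐ (inj₂ (inj₂ (refl , _ , sj∉))) = ((γ , γ∈Γ , γ⊑right) , right≢γ) , right-minimal sj∉

    removed : List Root
    removed = remove γ (ideal n Γ)

    ∈-removed⁺ : ∀ {y} → IsRoot n y → InIdeal⁻ y → y ∈ removed
    ∈-removed⁺ y-root (yI , y≢γ) = ∈-filter⁺ _ (∈-ideal⁺ y-root yI) (T-not⁺ (y≢γ ∘ eqRoot⇒≡))

    ∈-removed⁻ : ∀ {y} → y ∈ removed → IsRoot n y × InIdeal⁻ y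
    ∈-removed⁻ y∈ = let y∈I , y≠γ = ∈-filter⁻ (λ x → T? (not (eqRoot x γ))) {xs = ideal n Γ} y∈
                        y-root , yI = ∈-ideal⁻ y∈I
                    in y-root , yI , λ { refl → T-not⁻ y≠γ (eqRoot-refl γ) }

    removed-roots : All (IsRoot n) removed
    removed-roots = All.tabulate (proj₁ ∘ ∈-removed⁻)

    minimalInRemoved : Root → Bool
    minimalInRemoved x = inIdeal x ∧ (not (eqRoot x γ) ∧ isMinimal n removed x)

    minimalInRemoved⁺ : ∀ {x} → Minimal InIdeal⁻ x → T (minimalInRemoved x)
    minimalInRemoved⁺ ((xI , x≢γ) , x-min) = Equivalence.from T-∧ (inIdeal⁺ xI , Equivalence.from T-∧
      (T-not⁺ (x≢γ ∘ eqRoot⇒≡) ,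
       isMinimal⁺ removed-roots λ y∈ → let y-root , yI⁻ = ∈-removed⁻ y∈ in x-min y-root yI⁻))

    minimalInRemoved⁻ : ∀ {x} → T (minimalInRemoved x) → Minimal InIdeal⁻ x
    minimalInRemoved⁻ t = let xI , t′ = Equivalence.to T-∧ t ; x≠γ , x-min = Equivalence.to T-∧ t′ in
      (inIdeal⁻ xI , λ { refl → T-not⁻ x≠γ (eqRoot-refl γ) }) ,
      λ y-root yI⁻ y⊑x → isMinimal⁻ removed-roots x-min (∈-removed⁺ y-root yI⁻) y⊑x

    length-minimals-removed : length (minimals n removed) ≡ count minimalInRemoved (posRoots n)
    length-minimals-removed = trans (length≡count _ removed)
      (trans (count-filter _ (λ x → not (eqRoot x γ)) (ideal n Γ)) (count-filter _ inIdeal (posRoots n)))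

    isLeft isRight : Root → Bool
    isLeft  x = eqRoot x left  ∧ leftOpen 𝐢 i
    isRight x = eqRoot x right ∧ rightOpen n 𝐣 j

    isLeft⁺ : ∀ {x} → LeftNew x → T (isLeft x)
    isLeft⁺ (refl , 2≤i , pi∉) = Equivalence.from T-∧ (eqRoot-refl left , leftOpen⁺ 2≤i pi∉)

    isLeft⁻ : ∀ {x} → T (isLeft x) → LeftNew x
    isLeft⁻ t = let x≡left , open-left = Equivalence.to T-∧ t in eqRoot⇒≡ x≡left , leftOpen⁻ open-left

    isRight⁺ : ∀ {x} → RightNew x → T (isRight x)
    isRight⁺ (refl , sj≤n , sj∉) = Equivalence.from T-∧ (eqRoot-refl right , rightOpen⁺ sj≤n sj∉)

    isRight⁻ : ∀ {x} → T (isRight x) → RightNew x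
    isRight⁻ t = let x≡right , open-right = Equivalence.to T-∧ t in eqRoot⇒≡ x≡right , rightOpen⁻ open-right

    minimalInRemoved≡ : ∀ {x} → IsRoot n x →
      minimalInRemoved x ≡ (minimalInIdeal x ∧ not (eqRoot x γ)) ∨ (isLeft x ∨ isRight x)
    minimalInRemoved≡ x-root = T-ext (reflect ∘ minimal-removal⇒ x-root ∘ minimalInRemoved⁻)
                                     (minimalInRemoved⁺ ∘ minimal-removal⇐ ∘ reify)
      where
      reflect : ∀ {x} → (Minimal InIdeal x × x ≢ γ) ⊎ LeftNew x ⊎ RightNew x →
        T ((minimalInIdeal x ∧ not (eqRoot x γ)) ∨ (isLeft x ∨ isRight x))
      reflect (inj₁ (x-min , x≢γ)) =
        Equivalence.from T-∨ (inj₁ (Equivalence.from T-∧ (minimalInIdeal⁺ x-min , T-not⁺ (x≢γ ∘ eqRoot⇒≡))))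
      reflect {x} (inj₂ new) = Equivalence.from (T-∨ {minimalInIdeal x ∧ not (eqRoot x γ)})
        (inj₂ (Equivalence.from T-∨ (Sum.map (isLeft⁺ {x}) (isRight⁺ {x}) new)))
      reify : ∀ {x} → T ((minimalInIdeal x ∧ not (eqRoot x γ)) ∨ (isLeft x ∨ isRight x)) →
        (Minimal InIdeal x × x ≢ γ) ⊎ LeftNew x ⊎ RightNew x
      reify t with Equivalence.to T-∨ t
      ... | inj₁ t′ = let x-min , x≠γ = Equivalence.to T-∧ t′ in
                      inj₁ (minimalInIdeal⁻ x-min , λ { refl → T-not⁻ x≠γ (eqRoot-refl γ) })
      ... | inj₂ t′ = inj₂ (Sum.map isLeft⁻ isRight⁻ (Equivalence.to T-∨ t′))

    minimal-count-at : ∀ {x} → IsRoot n x →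
      χ (minimalInRemoved x) + χ (eqRoot x γ) ≡ χ (minimalInIdeal x) + (χ (isLeft x) + χ (isRight x))
    minimal-count-at {x} x-root = trans (cong (λ b → χ b + χ (eqRoot x γ)) (minimalInRemoved≡ x-root))
      (χ-partition (minimalInIdeal x) (eqRoot x γ) (isLeft x) (isRight x)
        (λ x≡γ → minimalInIdeal⁺ (subst (Minimal InIdeal) (sym (eqRoot⇒≡ x≡γ)) (Γ-minimal γ∈Γ)))
        (λ x-min x-left → left-not-minimal (subst (Minimal InIdeal) (proj₁ (isLeft⁻ x-left)) (minimalInIdeal⁻ x-min)))
        (λ x-min x-right → right-not-minimal
          (subst (Minimal InIdeal) (proj₁ (isRight⁻ x-right)) (minimalInIdeal⁻ x-min)))
        (λ x-left x-right → left≢right (trans (sym (proj₁ (isLeft⁻ {x} x-left))) (proj₁ (isRight⁻ {x} x-right)))))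

    left-root : T (leftOpen 𝐢 i) → IsRoot n left
    left-root open-left = pred-mono-≤ (proj₁ (leftOpen⁻ {i} {𝐢} open-left)) , ≤-trans pred[n]≤n i≤j , j≤n

    right-root : T (rightOpen n 𝐣 j) → IsRoot n right
    right-root open-right = 1≤i , ≤-trans (i≤j) (n≤1+n j) , proj₁ (rightOpen⁻ {n} {j} {𝐣} open-right)

    removal-count : length (minimals n removed) + 1 ≡
                    length (minimals n (ideal n Γ)) + (χ (leftOpen 𝐢 i) + χ (rightOpen n 𝐣 j))
    removal-count = begin
      length (minimals n removed) + 1
        ≡⟨ cong₂ _+_ length-minimals-removed (sym (count-eqRoot γ-root)) ⟩
      count minimalInRemoved R + count (λ x → eqRoot x γ) R
        ≡⟨ sym (∑-+ _ _ R) ⟩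
      ∑ (λ x → χ (minimalInRemoved x) + χ (eqRoot x γ)) R
        ≡⟨ ∑-cong R (minimal-count-at ∘ ∈-posRoots⁻) ⟩
      ∑ (λ x → χ (minimalInIdeal x) + (χ (isLeft x) + χ (isRight x))) R
        ≡⟨ trans (∑-+ _ _ R) (cong (count minimalInIdeal R +_) (∑-+ _ _ R)) ⟩
      count minimalInIdeal R + (count isLeft R + count isRight R)
        ≡⟨ cong₂ _+_ (sym length-minimals)
                     (cong₂ _+_ (count-eqRoot-∧ left _ left-root) (count-eqRoot-∧ right _ right-root)) ⟩
      length (minimals n (ideal n Γ)) + (χ (leftOpen 𝐢 i) + χ (rightOpen n 𝐣 j)) ∎
      where
      open ≡-Reasoning
      R = posRoots n

    rΓ-value : rΓ n Γ γ ≡ ℤ.+ (χ (leftOpen 𝐢 i) + χ (rightOpen n 𝐣 j))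
    rΓ-value = difference-from-sum (length (minimals n removed)) (length (minimals n (ideal n Γ))) removal-count

  OY-boundaries : OY n Γ ≡ ℤ.+ (leftBoundary 𝐢 + rightBoundary n 𝐣)
  OY-boundaries = begin
    sumℤ (map (rΓ n Γ) Γ)
      ≡⟨ sumℤ-map (rΓ n Γ) _ (λ { {_ , _} γ∈ → Removal.rΓ-value γ∈ }) ⟩
    ℤ.+ ∑ (λ x → χ (leftOpen 𝐢 (proj₁ x)) + χ (rightOpen n 𝐣 (proj₂ x))) Γ
      ≡⟨ cong ℤ.+_ (trans (∑-+ _ _ Γ) (sym (cong₂ _+_ (∑-map _ proj₁ Γ) (∑-map _ proj₂ Γ)))) ⟩
    ℤ.+ (leftBoundary 𝐢 + rightBoundary n 𝐣) ∎
    where open ≡-Reasoning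

  𝐢-unique : Unique 𝐢
  𝐢-unique = AllPairs.map⁺ (AllPairs.map (λ {x} {y} → incomparable⇒proj₁≢ n {x} {y}) (proj₂ Γ-antichain))

  𝐣-unique : Unique 𝐣
  𝐣-unique = AllPairs.map⁺ (AllPairs.map (λ {x} {y} → incomparable⇒proj₂≢ n {x} {y}) (proj₂ Γ-antichain))

  𝐢⊆range : 𝐢 ⊆ range n
  𝐢⊆range k∈ with ∈-map⁻ proj₁ k∈
  ... | _ , γ∈ , refl = let 1≤i , i≤j , j≤n = All.lookup Γ-roots γ∈ in ∈-range⁺ 1≤i (≤-trans i≤j j≤n)

  𝐣⊆range : 𝐣 ⊆ range n
  𝐣⊆range k∈ with ∈-map⁻ proj₂ k∈
  ... | _ , γ∈ , refl = let 1≤i , i≤j , j≤n = All.lookup Γ-roots γ∈ in ∈-range⁺ (≤-trans 1≤i i≤j) j≤n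

-- Duality

module Duality {n : ℕ} {Γ : List Root} (Γ-antichain : IsAntichain n Γ) where

  open Antichain Γ-antichain

  -- dual n Γ unfolds to zip 𝐢* 𝐣*.
  𝐢* 𝐣* : List ℕ
  𝐢* = compl n 𝐣
  𝐣* = compl n 𝐢

  count-𝐣≤count-𝐢 : ∀ m → count (_≤ᵇ m) 𝐣 ≤ count (_≤ᵇ m) 𝐢
  count-𝐣≤count-𝐢 m = subst₂ _≤_ (sym (∑-map _ proj₂ Γ)) (sym (∑-map _ proj₁ Γ))
    (∑-mono Γ λ γ∈ → χ-≤ᵇ-antitone m (proj₁ (proj₂ (All.lookup Γ-roots γ∈))))

  count-𝐣*≤count-𝐢* : ∀ m → count (_≤ᵇ m) 𝐣* ≤ count (_≤ᵇ m) 𝐢*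
  count-𝐣*≤count-𝐢* m = +-cancelʳ-≤ (count (_≤ᵇ m) 𝐣) _ _ (begin
    count (_≤ᵇ m) 𝐣* + count (_≤ᵇ m) 𝐣 ≤⟨ +-monoʳ-≤ _ (count-𝐣≤count-𝐢 m) ⟩
    count (_≤ᵇ m) 𝐣* + count (_≤ᵇ m) 𝐢 ≡⟨ ∑-compl _ 𝐢-unique 𝐢⊆range ⟩
    count (_≤ᵇ m) (range n)            ≡⟨ sym (∑-compl _ 𝐣-unique 𝐣⊆range) ⟩
    count (_≤ᵇ m) 𝐢* + count (_≤ᵇ m) 𝐣 ∎)
    where open ≤-Reasoning

  length-𝐢*≡length-𝐣* : length 𝐢* ≡ length 𝐣*
  length-𝐢*≡length-𝐣* = +-cancelʳ-≡ (length Γ) _ _ (begin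
    length 𝐢* + length Γ
      ≡⟨ cong₂ _+_ (length≡∑ 𝐢*) (trans (sym (length-map proj₂ Γ)) (length≡∑ 𝐣)) ⟩
    ∑ (λ _ → 1) 𝐢* + ∑ (λ _ → 1) 𝐣
      ≡⟨ ∑-compl _ 𝐣-unique 𝐣⊆range ⟩
    ∑ (λ _ → 1) (range n)
      ≡⟨ sym (∑-compl _ 𝐢-unique 𝐢⊆range) ⟩
    ∑ (λ _ → 1) 𝐣* + ∑ (λ _ → 1) 𝐢
      ≡⟨ sym (cong₂ _+_ (length≡∑ 𝐣*) (trans (sym (length-map proj₁ Γ)) (length≡∑ 𝐢))) ⟩
    length 𝐣* + length Γ ∎)
    where open ≡-Reasoning

  dual-antichain : IsAntichain n (dual n Γ)
  dual-antichain = dual-roots , increasing⇒antichain n dual-roots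
    (AllPairs-zip (AllPairs.filter⁺ _ (range-increasing n)) (AllPairs.filter⁺ _ (range-increasing n)))
    where
    dual-roots : All (IsRoot n) (zip 𝐢* 𝐣*)
    dual-roots = All.zipWith (λ (((1≤a , _) , (_ , b≤n)) , a≤b) → 1≤a , a≤b , b≤n)
      (All-zip (All.tabulate (∈-range⁻ ∘ compl⊆range n 𝐣)) (All.tabulate (∈-range⁻ ∘ compl⊆range n 𝐢)) ,
       zip-≤ (AllPairs.filter⁺ _ (range-increasing n)) (AllPairs.filter⁺ _ (range-increasing n)) count-𝐣*≤count-𝐢*)

  OY-dual-boundaries : OY n (dual n Γ) ≡ ℤ.+ (leftBoundary 𝐢* + rightBoundary n 𝐣*)
  OY-dual-boundaries = begin
    OY n (dual n Γ)
      ≡⟨ Antichain.OY-boundaries dual-antichain ⟩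
    ℤ.+ (leftBoundary (map proj₁ (zip 𝐢* 𝐣*)) + rightBoundary n (map proj₂ (zip 𝐢* 𝐣*)))
      ≡⟨ cong₂ (λ xs ys → ℤ.+ (leftBoundary xs + rightBoundary n ys))
               (map-proj₁-zip 𝐢* 𝐣* length-𝐢*≡length-𝐣*) (map-proj₂-zip 𝐢* 𝐣* length-𝐢*≡length-𝐣*) ⟩
    ℤ.+ (leftBoundary 𝐢* + rightBoundary n 𝐣*) ∎
    where open ≡-Reasoning

mainTheorem4 : (n : ℕ) → 1 ≤ n → (Γ : List Root) → IsAntichain n Γ →
    OY n Γ ≡ OY n (dual n Γ)
mainTheorem4 n _ Γ Γ-antichain = begin
  OY n Γ
    ≡⟨ OY-boundaries ⟩
  ℤ.+ (leftBoundary 𝐢 + rightBoundary n 𝐣)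
    ≡⟨ cong ℤ.+_ (cong₂ _+_ (leftBoundary-compl 𝐢-unique 𝐢⊆range) (rightBoundary-compl 𝐣-unique 𝐣⊆range)) ⟩
  ℤ.+ (rightBoundary n 𝐣* + leftBoundary 𝐢*)
    ≡⟨ cong ℤ.+_ (+-comm (rightBoundary n 𝐣*) (leftBoundary 𝐢*)) ⟩
  ℤ.+ (leftBoundary 𝐢* + rightBoundary n 𝐣*)
    ≡⟨ sym OY-dual-boundaries ⟩
  OY n (dual n Γ) ∎
  where
  open Antichain Γ-antichain
  open Duality Γ-antichain
  open ≡-Reasoning
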